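{- Let $\gamma_0,\dots,\gamma_k$ and $\delta_0,\dots,\delta_k$ be elements with $\gamma_i,\delta_i\in\mathcal P_{n_i}$ and $\gamma_i\le_B\delta_i$ in $\mathcal P_{n_i}$ for each $i$. Then $\gamma_0\times\dots\times\gamma_k\le_B\delta_0\times\dots\times\delta_k$.
   Context: For $n\ge1$, $\mathcal P_n$ is the set of surjective maps $\gamma:\{1,\dots,n\}\to\{1,\dots,r\}$ ($r\ge1$), $\mathcal P_{n,r}$ those with image $\{1,\dots,r\}$; $\mathcal P_0=\{(0)\}$ (with $\le_B$ trivial). For $\gamma\in\mathcal P_{n,r}$, $\delta\in\mathcal P_{m,s}$, $\gamma\times\delta=(\gamma(1),\dots,\gamma(n),\delta(1)+r,\dots,\delta(m)+r)$; $\gamma\times(0)=(0)\times\gamma=\gamma$. For $r\ge2$, $1\le i\le r-1$, $t_i\in\mathcal P_{r,r-1}$: $t_i(j)=j$ ($j\le i$), $j-1$ ($j>i$). $\gamma^{ -1}(i)<\gamma^{ -1}(i+1)$ means every element of $\gamma^{ -1}(i)$ is less than every element of $\gamma^{ -1}(i+1)$. The weak Bruhat order $\le_B$ on $\mathcal P_n$ is the reflexive transitive closure of: $\gamma<_B t_i\circ\gamma$ if $\gamma^{ -1}(i)<\gamma^{ -1}(i+1)$, and $t_i\circ\gamma<_B\gamma$ if $\gamma^{ -1}(i)>\gamma^{ -1}(i+1)$. -}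

module Defs where

open import Data.Nat using (ℕ; zero; suc; _+_)
open import Data.Fin using (Fin; zero; suc; inject₁; _↑ˡ_; _↑ʳ_; _<_; _≤_)
open import Data.Vec using (Vec; lookup; map; _++_)
open import Data.Product using (Σ; ∃; _,_)
open import Relation.Binary.PropositionalEquality using (_≡_)
open import Relation.Binary.Construct.Closure.ReflexiveTransitive using (Star)

-- A map {1..n} → {1..r}, encoded 0-based as (r , vector of values in Fin r).
Map : ℕ → Set
Map n = Σ ℕ (λ r → Vec (Fin r) n)

IsSurj : ∀ {n} → Map n → Set
IsSurj {n} (r , v) = (j : Fin r) → ∃ λ (p : Fin n) → lookup v p ≡ j

P : ℕ → Set
P n = Σ (Map n) IsSurj

-- t_i : {1..m+1} → {1..m} (paper's r = m+1, i = 1+toℕ i, 1 ≤ i ≤ r-1), 0-based: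
-- t i j = j if j ≤ i, and j - 1 if j > i.
t : ∀ {m} → Fin m → Fin (suc m) → Fin m
t {suc m} i zero = zero
t {suc m} zero (suc j) = j
t {suc m} (suc i) (suc j) = suc (t i j)

-- γ⁻¹(a) < γ⁻¹(b): every preimage of a is before every preimage of b
PreLt : ∀ {n r} → Vec (Fin r) n → Fin r → Fin r → Set
PreLt {n} v a b = (p q : Fin n) → lookup v p ≡ a → lookup v q ≡ b → p < q

data Step {n : ℕ} : Map n → Map n → Set where
  up   : ∀ {m} (v : Vec (Fin (suc m)) n) (i : Fin m) → IsSurj (suc m , v) →
         PreLt v (inject₁ i) (suc i) → Step (suc m , v) (m , map (t i) v)
  down : ∀ {m} (v : Vec (Fin (suc m)) n) (i : Fin m) → IsSurj (suc m , v) →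
         PreLt v (suc i) (inject₁ i) → Step (m , map (t i) v) (suc m , v)

_≤B_ : ∀ {n} → P n → P n → Set
_≤B_ {n} (γ , _) (δ , _) = Star (Step {n}) γ δ

_×M_ : ∀ {n m} → Map n → Map m → Map (n + m)
(r , v) ×M (s , w) = (r + s , map (_↑ˡ s) v ++ map (r ↑ʳ_) w)

sizeAll : ∀ k → (Fin (suc k) → ℕ) → ℕ
sizeAll zero ns = ns zero
sizeAll (suc k) ns = ns zero + sizeAll k (λ i → ns (suc i))

prodMap : ∀ k (ns : Fin (suc k) → ℕ) → ((i : Fin (suc k)) → Map (ns i)) → Map (sizeAll k ns)
prodMap zero ns γ = γ zero
prodMap (suc k) ns γ = γ zero ×M prodMap k (λ i → ns (suc i)) (λ i → γ (suc i))

{-# OPTIONS --safe #-}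
module Submission where

-- The order ≤B is generated by single moves γ ↦ t_i ∘ γ.  In a product γ × δ the values
-- of γ form the initial block {1..r} and those of δ the block {r+1..r+s}, and the
-- positions of γ all precede those of δ.  A move t_i on one factor is therefore the move
-- t_i (resp. t_{r+i}) of the product: it only relabels values inside that factor's block,
-- and the condition γ⁻¹(i) < γ⁻¹(i+1) only concerns positions of that factor.  Hence
-- × is monotone in each argument when the other is fixed, and the theorem follows by
-- induction on k, moving γ₀ to δ₀ first and then the remaining factors.

open import Defs
open import Data.Nat using (ℕ; zero; suc; _+_; s≤s)
  renaming (_<_ to _<ℕ_; _≤_ to _≤ℕ_)
open import Data.Nat.Properties
  using (+-suc; +-cancelˡ-≡; m<n⇒m<1+n; +-monoʳ-<; <-≤-trans; <⇒≤; m≤m+n; m≤n⇒m≤n+o; m+n≮m)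
open import Data.Fin using (Fin; zero; suc; toℕ; _↑ˡ_; _↑ʳ_)
open import Data.Fin.Properties using (toℕ-injective; toℕ-↑ˡ; toℕ-↑ʳ; toℕ-inject₁; toℕ<n)
open import Data.Vec using (Vec; lookup; map)
open import Data.Vec.Properties
  using (lookup-map; lookup-++ˡ; lookup-++ʳ; tabulate∘lookup; tabulate-cong)
open import Data.Product using (proj₁; proj₂; _,_)
open import Data.Empty using (⊥-elim)
open import Relation.Binary.PropositionalEquality
  using (_≡_; _≢_; refl; sym; trans; cong; subst; module ≡-Reasoning)
open import Relation.Binary.Construct.Closure.ReflexiveTransitive
  using (Star; _◅◅_; gmap)

lookup-extensionality : ∀ {A : Set} {n} {u w : Vec A n} →
                        (∀ p → lookup u p ≡ lookup w p) → u ≡ w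
lookup-extensionality {u = u} {w} h =
  trans (sym (tabulate∘lookup u)) (trans (tabulate-cong h) (tabulate∘lookup w))

data Split (m n : ℕ) : Fin (m + n) → Set where
  left  : (p : Fin m) → Split m n (p ↑ˡ n)
  right : (q : Fin n) → Split m n (m ↑ʳ q)

split : ∀ m n (p : Fin (m + n)) → Split m n p
split zero    n p       = right p
split (suc m) n zero    = left zero
split (suc m) n (suc p) with split m n p
... | left p′  = left (suc p′)
... | right q  = right q

↑ˡ-mono-< : ∀ {m} n {p q : Fin m} → toℕ p <ℕ toℕ q → toℕ (p ↑ˡ n) <ℕ toℕ (q ↑ˡ n)
↑ˡ-mono-< n {p} {q} p<q rewrite toℕ-↑ˡ p n | toℕ-↑ˡ q n = p<q

↑ʳ-mono-< : ∀ m {n} {p q : Fin n} → toℕ p <ℕ toℕ q → toℕ (m ↑ʳ p) <ℕ toℕ (m ↑ʳ q)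
↑ʳ-mono-< m {p = p} {q} p<q rewrite toℕ-↑ʳ m p | toℕ-↑ʳ m q = +-monoʳ-< m p<q

↑ˡ<↑ʳ : ∀ {m n} (p : Fin m) (q : Fin n) → toℕ (p ↑ˡ n) <ℕ toℕ (m ↑ʳ q)
↑ˡ<↑ʳ {m} {n} p q rewrite toℕ-↑ˡ p n | toℕ-↑ʳ m q = <-≤-trans (toℕ<n p) (m≤m+n m (toℕ q))

toℕ≢+ : ∀ {r} (c : Fin r) a → toℕ c ≢ r + a
toℕ≢+ {r} c a eq = m+n≮m r a (subst (_<ℕ r) eq (toℕ<n c))

-- Moves are compared through toℕ: this avoids casting between Fin (r + suc m) and
-- Fin (suc (r + m)), which are not definitionally equal.
tℕ : ℕ → ℕ → ℕ
tℕ i       zero    = zero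
tℕ zero    (suc j) = j
tℕ (suc i) (suc j) = suc (tℕ i j)

toℕ-t : ∀ {m} (i : Fin m) (j : Fin (suc m)) → toℕ (t i j) ≡ tℕ (toℕ i) (toℕ j)
toℕ-t {suc m} i       zero    = refl
toℕ-t {suc m} zero    (suc j) = refl
toℕ-t {suc m} (suc i) (suc j) = cong suc (toℕ-t i j)

tℕ-below : ∀ i j → j ≤ℕ i → tℕ i j ≡ j
tℕ-below i       zero    _         = refl
tℕ-below (suc i) (suc j) (s≤s j≤i) = cong suc (tℕ-below i j j≤i)

tℕ-above : ∀ i j → i ≤ℕ j → tℕ i (suc j) ≡ j
tℕ-above zero    j       _         = refl
tℕ-above (suc i) (suc j) (s≤s i≤j) = cong suc (tℕ-above i j i≤j)

tℕ-shift : ∀ r i j → tℕ (r + i) (r + j) ≡ r + tℕ i j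
tℕ-shift zero    i j = refl
tℕ-shift (suc r) i j = cong suc (tℕ-shift r i j)

PreLtℕ : ∀ {n r} → Vec (Fin r) n → ℕ → ℕ → Set
PreLtℕ {n} v a b =
  (p q : Fin n) → toℕ (lookup v p) ≡ a → toℕ (lookup v q) ≡ b → toℕ p <ℕ toℕ q

PreLt⇒PreLtℕ : ∀ {n r} (v : Vec (Fin r) n) {x y : Fin r} {a b : ℕ} →
               toℕ x ≡ a → toℕ y ≡ b → PreLt v x y → PreLtℕ v a b
PreLt⇒PreLtℕ v refl refl x<y p q ex ey = x<y p q (toℕ-injective ex) (toℕ-injective ey)

PreLtℕ⇒PreLt : ∀ {n r} (v : Vec (Fin r) n) {x y : Fin r} {a b : ℕ} →
               toℕ x ≡ a → toℕ y ≡ b → PreLtℕ v a b → PreLt v x y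
PreLtℕ⇒PreLt v refl refl a<b p q ex ey = a<b p q (cong toℕ ex) (cong toℕ ey)

toℕ-lookup-map-t : ∀ {n m} (i : Fin m) (v : Vec (Fin (suc m)) n) p →
                   toℕ (lookup (map (t i) v) p) ≡ tℕ (toℕ i) (toℕ (lookup v p))
toℕ-lookup-map-t i v p = trans (cong toℕ (lookup-map p (t i) v)) (toℕ-t i (lookup v p))

map-t-via-toℕ : ∀ {n m} (i : Fin m) (v : Vec (Fin (suc m)) n) (w : Vec (Fin m) n) →
                (∀ p → toℕ (lookup w p) ≡ tℕ (toℕ i) (toℕ (lookup v p))) → map (t i) v ≡ w
map-t-via-toℕ i v w h = lookup-extensionality λ p →
  toℕ-injective (trans (toℕ-lookup-map-t i v p) (sym (h p)))

up-via-toℕ : ∀ {n r m} (r≡1+m : r ≡ suc m) (v : Vec (Fin r) n) (w : Vec (Fin m) n)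
             (i : Fin m) {a : ℕ} → toℕ i ≡ a → IsSurj (r , v) → PreLtℕ v a (suc a) →
             (∀ p → toℕ (lookup w p) ≡ tℕ a (toℕ (lookup v p))) → Step (r , v) (m , w)
up-via-toℕ refl v w i refl surj a<a+1 tv≡w
  rewrite sym (map-t-via-toℕ i v w tv≡w) =
  up v i surj (PreLtℕ⇒PreLt v (toℕ-inject₁ i) refl a<a+1)

down-via-toℕ : ∀ {n r m} (r≡1+m : r ≡ suc m) (v : Vec (Fin r) n) (w : Vec (Fin m) n)
               (i : Fin m) {a : ℕ} → toℕ i ≡ a → IsSurj (r , v) → PreLtℕ v (suc a) a →
               (∀ p → toℕ (lookup w p) ≡ tℕ a (toℕ (lookup v p))) → Step (m , w) (r , v)
down-via-toℕ refl v w i refl surj a+1<a tv≡w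
  rewrite sym (map-t-via-toℕ i v w tv≡w) =
  down v i surj (PreLtℕ⇒PreLt v refl (toℕ-inject₁ i) a+1<a)

module _ {n n′ r s : ℕ} (v : Vec (Fin r) n) (w : Vec (Fin s) n′) where

  private
    vw = proj₂ ((r , v) ×M (s , w))

  toℕ-lookup-×M-↑ˡ : ∀ p → toℕ (lookup vw (p ↑ˡ n′)) ≡ toℕ (lookup v p)
  toℕ-lookup-×M-↑ˡ p = begin
    toℕ (lookup vw (p ↑ˡ n′))                ≡⟨ cong toℕ (lookup-++ˡ (map (_↑ˡ s) v) _ p) ⟩
    toℕ (lookup (map (_↑ˡ s) v) p)           ≡⟨ cong toℕ (lookup-map p (_↑ˡ s) v) ⟩
    toℕ (lookup v p ↑ˡ s)                    ≡⟨ toℕ-↑ˡ (lookup v p) s ⟩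
    toℕ (lookup v p)                         ∎
    where open ≡-Reasoning

  toℕ-lookup-×M-↑ʳ : ∀ q → toℕ (lookup vw (n ↑ʳ q)) ≡ r + toℕ (lookup w q)
  toℕ-lookup-×M-↑ʳ q = begin
    toℕ (lookup vw (n ↑ʳ q))                 ≡⟨ cong toℕ (lookup-++ʳ (map (_↑ˡ s) v) _ q) ⟩
    toℕ (lookup (map (r ↑ʳ_) w) q)           ≡⟨ cong toℕ (lookup-map q (r ↑ʳ_) w) ⟩
    toℕ (r ↑ʳ lookup w q)                    ≡⟨ toℕ-↑ʳ r (lookup w q) ⟩
    r + toℕ (lookup w q)                     ∎
    where open ≡-Reasoning

  PreLtℕ-×Mˡ : ∀ {a b} → a <ℕ r → PreLtℕ v a b → PreLtℕ vw a b
  PreLtℕ-×Mˡ a<r a<b p q ea eb with split n n′ p | split n n′ q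
  ... | left p′  | left q′ = ↑ˡ-mono-< n′ (a<b p′ q′
          (trans (sym (toℕ-lookup-×M-↑ˡ p′)) ea) (trans (sym (toℕ-lookup-×M-↑ˡ q′)) eb))
  ... | left p′  | right q′ = ↑ˡ<↑ʳ p′ q′
  ... | right p′ | _        =
          ⊥-elim (m+n≮m r _ (subst (_<ℕ r) (trans (sym ea) (toℕ-lookup-×M-↑ʳ p′)) a<r))

  PreLtℕ-×Mʳ : ∀ {a b} → PreLtℕ w a b → PreLtℕ vw (r + a) (r + b)
  PreLtℕ-×Mʳ a<b p q ea eb with split n n′ p | split n n′ q
  ... | left p′  | _        = ⊥-elim (toℕ≢+ (lookup v p′) _ (trans (sym (toℕ-lookup-×M-↑ˡ p′)) ea))
  ... | right _  | left q′  = ⊥-elim (toℕ≢+ (lookup v q′) _ (trans (sym (toℕ-lookup-×M-↑ˡ q′)) eb))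
  ... | right p′ | right q′ = ↑ʳ-mono-< n (a<b p′ q′
          (+-cancelˡ-≡ r _ _ (trans (sym (toℕ-lookup-×M-↑ʳ p′)) ea))
          (+-cancelˡ-≡ r _ _ (trans (sym (toℕ-lookup-×M-↑ʳ q′)) eb)))

×M-surjective : ∀ {n n′} (x : Map n) (y : Map n′) → IsSurj x → IsSurj y → IsSurj (x ×M y)
×M-surjective {n} {n′} (r , v) (s , w) surj-v surj-w c with split r s c
... | left c′  with surj-v c′
...   | p , vp≡c′ = p ↑ˡ n′ ,
          trans (lookup-++ˡ (map (_↑ˡ s) v) _ p) (trans (lookup-map p (_↑ˡ s) v) (cong (_↑ˡ s) vp≡c′))
×M-surjective {n} {n′} (r , v) (s , w) surj-v surj-w c | right c′ with surj-w c′
...   | q , wq≡c′ = n ↑ʳ q ,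
          trans (lookup-++ʳ (map (_↑ˡ s) v) _ q) (trans (lookup-map q (r ↑ʳ_) w) (cong (r ↑ʳ_) wq≡c′))

toℕ-lookup-×M-relabel :
  ∀ {n n′ r r′ s s′} (f : ℕ → ℕ)
  (v : Vec (Fin r) n) (v′ : Vec (Fin r′) n) (w : Vec (Fin s) n′) (w′ : Vec (Fin s′) n′) →
  (∀ p → toℕ (lookup v′ p) ≡ f (toℕ (lookup v p))) →
  (∀ q → r′ + toℕ (lookup w′ q) ≡ f (r + toℕ (lookup w q))) →
  ∀ p → toℕ (lookup (proj₂ ((r′ , v′) ×M (s′ , w′))) p)
      ≡ f (toℕ (lookup (proj₂ ((r , v) ×M (s , w))) p))
toℕ-lookup-×M-relabel {n} {n′} f v v′ w w′ hv hw p with split n n′ p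
... | left p′  = trans (toℕ-lookup-×M-↑ˡ v′ w′ p′)
                   (trans (hv p′) (cong f (sym (toℕ-lookup-×M-↑ˡ v w p′))))
... | right q′ = trans (toℕ-lookup-×M-↑ʳ v′ w′ q′)
                   (trans (hw q′) (cong f (sym (toℕ-lookup-×M-↑ʳ v w q′))))

t-×Mˡ : ∀ {n n′ m s} (i : Fin m) (v : Vec (Fin (suc m)) n) (w : Vec (Fin s) n′) p →
        toℕ (lookup (proj₂ ((m , map (t i) v) ×M (s , w))) p)
        ≡ tℕ (toℕ i) (toℕ (lookup (proj₂ ((suc m , v) ×M (s , w))) p))
t-×Mˡ {m = m} i v w = toℕ-lookup-×M-relabel (tℕ (toℕ i)) v (map (t i) v) w w
  (toℕ-lookup-map-t i v)
  (λ q → sym (tℕ-above (toℕ i) _ (m≤n⇒m≤n+o (toℕ (lookup w q)) (<⇒≤ (toℕ<n i)))))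

t-×Mʳ : ∀ {n n′ r m} (i : Fin m) (u : Vec (Fin r) n) (w : Vec (Fin (suc m)) n′) p →
        toℕ (lookup (proj₂ ((r , u) ×M (m , map (t i) w))) p)
        ≡ tℕ (r + toℕ i) (toℕ (lookup (proj₂ ((r , u) ×M (suc m , w))) p))
t-×Mʳ {r = r} i u w = toℕ-lookup-×M-relabel (tℕ (r + toℕ i)) u u w (map (t i) w)
  (λ p → sym (tℕ-below _ _ (m≤n⇒m≤n+o (toℕ i) (<⇒≤ (toℕ<n (lookup u p))))))
  (λ q → trans (cong (r +_) (toℕ-lookup-map-t i w q)) (sym (tℕ-shift r _ _)))

Step-×Mˡ : ∀ {n n′} {x y : Map n} (z : Map n′) → IsSurj z → Step x y → Step (x ×M z) (y ×M z)
Step-×Mˡ (s , w) surj-w (up {m} v i surj-v v<) =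
  up-via-toℕ refl _ _ (i ↑ˡ s) (toℕ-↑ˡ i s)
    (×M-surjective (suc m , v) (s , w) surj-v surj-w)
    (PreLtℕ-×Mˡ v w (m<n⇒m<1+n (toℕ<n i)) (PreLt⇒PreLtℕ v (toℕ-inject₁ i) refl v<))
    (t-×Mˡ i v w)
Step-×Mˡ (s , w) surj-w (down {m} v i surj-v v<) =
  down-via-toℕ refl _ _ (i ↑ˡ s) (toℕ-↑ˡ i s)
    (×M-surjective (suc m , v) (s , w) surj-v surj-w)
    (PreLtℕ-×Mˡ v w (s≤s (toℕ<n i)) (PreLt⇒PreLtℕ v refl (toℕ-inject₁ i) v<))
    (t-×Mˡ i v w)

Step-×Mʳ : ∀ {n n′} {x y : Map n′} (z : Map n) → IsSurj z → Step x y → Step (z ×M x) (z ×M y)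
Step-×Mʳ (r , u) surj-u (up {m} w i surj-w w<) =
  up-via-toℕ (+-suc r m) uw _ (r ↑ʳ i) (toℕ-↑ʳ r i)
    (×M-surjective (r , u) (suc m , w) surj-u surj-w)
    (subst (PreLtℕ uw (r + toℕ i)) (+-suc r (toℕ i))
      (PreLtℕ-×Mʳ u w (PreLt⇒PreLtℕ w (toℕ-inject₁ i) refl w<)))
    (t-×Mʳ i u w)
  where uw = proj₂ ((r , u) ×M (suc m , w))
Step-×Mʳ (r , u) surj-u (down {m} w i surj-w w<) =
  down-via-toℕ (+-suc r m) uw _ (r ↑ʳ i) (toℕ-↑ʳ r i)
    (×M-surjective (r , u) (suc m , w) surj-u surj-w)
    (subst (λ b → PreLtℕ uw b (r + toℕ i)) (+-suc r (toℕ i))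
      (PreLtℕ-×Mʳ u w (PreLt⇒PreLtℕ w refl (toℕ-inject₁ i) w<)))
    (t-×Mʳ i u w)
  where uw = proj₂ ((r , u) ×M (suc m , w))

prodMap-surjective : ∀ k (ns : Fin (suc k) → ℕ) (γ : (i : Fin (suc k)) → P (ns i)) →
                     IsSurj (prodMap k ns (λ i → proj₁ (γ i)))
prodMap-surjective zero    ns γ = proj₂ (γ zero)
prodMap-surjective (suc k) ns γ =
  ×M-surjective (proj₁ (γ zero)) _ (proj₂ (γ zero))
    (prodMap-surjective k (λ i → ns (suc i)) (λ i → γ (suc i)))

mainTheorem7 : (k : ℕ) (ns : Fin (suc k) → ℕ) (γ δ : (i : Fin (suc k)) → P (ns i)) →
    ((i : Fin (suc k)) → γ i ≤B δ i) →
    Star Step (prodMap k ns (λ i → proj₁ (γ i))) (prodMap k ns (λ i → proj₁ (δ i)))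
mainTheorem7 zero    ns γ δ γ≤δ = γ≤δ zero
mainTheorem7 (suc k) ns γ δ γ≤δ =
  gmap (_×M γ-tail) (Step-×Mˡ γ-tail (prodMap-surjective k ns′ (λ i → γ (suc i)))) (γ≤δ zero)
  ◅◅ gmap (proj₁ (δ zero) ×M_) (Step-×Mʳ (proj₁ (δ zero)) (proj₂ (δ zero)))
       (mainTheorem7 k ns′ (λ i → γ (suc i)) (λ i → δ (suc i)) (λ i → γ≤δ (suc i)))
  where
  ns′ : Fin (suc k) → ℕ
  ns′ i = ns (suc i)
  γ-tail : Map (sizeAll k ns′)
  γ-tail = prodMap k ns′ (λ i → proj₁ (γ (suc i)))
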